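{- Let $T$ be a tree rooted at $r$. Let $V_1, V_2 \subseteq V(T)$ be disjoint sets such that $V_1$ is the vertex set of a collection $\mathcal{P}_1$ of pairwise vertex-disjoint downward paths of $T$ and $V_2$ is the vertex set of a collection $\mathcal{P}_2$ of pairwise vertex-disjoint downward paths of $T$, and suppose there is a bijection $\phi:\mathcal{P}_1\to\mathcal{P}_2$ such that for each $P\in\mathcal{P}_1$, if $P$ starts at the vertex $v$, then $\phi(P)$ has the same number of vertices as $P$ and starts at a sibling of $v$ (a vertex $v'\ne v$ with the same parent as $v$). If every pair of distinct paths in $\mathcal{P}_1\cup\mathcal{P}_2$ is independent, then $V_1$ and $V_2$ are homometric.
   Context: A downward path starting at $v$ in a rooted tree is a path $v=u_1,u_2,\ldots,u_t$ in which each $u_{j+1}$ is a child of $u_j$. Two paths $P, Q$ of a rooted tree $T$ are independent if there is no root-to-leaf path in $T$ sharing a vertex with both $P$ and $Q$. For $V'\subseteq V(T)$, the profile of $V'$ is the multiset of pairwise distances in $T$ between the vertices of $V'$; two disjoint vertex sets are homometric if their profiles are equal. -}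

module Defs where

open import Data.Nat using (ℕ; zero; suc; _+_; _<_)
open import Data.Fin using (Fin; fromℕ<)
open import Data.List using (List; []; _∷_; _++_; _∷ʳ_; length; map; take; upTo; concatMap; allFin; lookup)
open import Data.List.Membership.Propositional using (_∈_)
open import Data.List.Relation.Binary.Disjoint.Propositional using (Disjoint)
open import Data.List.Relation.Binary.Permutation.Propositional using (_↭_)
open import Data.Product using (Σ; _×_; ∃; ∃-syntax)
open import Data.Unit using (⊤)
open import Data.Empty using (⊥)
open import Data.Bool using (if_then_else_)
open import Relation.Nullary using (¬_)
open import Relation.Binary.PropositionalEquality using (_≡_; _≢_)
import Data.Nat as ℕ

-- A finite rooted tree (ordered children; the ordering is irrelevant extra data).
data Tree : Set where
  node : List Tree → Tree

-- Vertices of a tree are addresses: the list of child indices from the root.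
-- The root is the empty address [].
Address : Set
Address = List ℕ

Valid : Tree → Address → Set
Valid t [] = ⊤
Valid (node ts) (i ∷ a) = Σ (i < length ts) λ h → Valid (lookup ts (fromℕ< h)) a

-- u is an ancestor-or-equal of w (u lies on the root-to-w path).
_⊑_ : Address → Address → Set
u ⊑ w = ∃[ s ] (u ++ s ≡ w)

IsLeaf : Tree → Address → Set
IsLeaf T a = Valid T a × (∀ i → ¬ Valid T (a ∷ʳ i))

Sibling : Address → Address → Set
Sibling v v' = ∃[ p ] ∃[ i ] ∃[ j ] (i ≢ j × v ≡ p ∷ʳ i × v' ≡ p ∷ʳ j)

dist : Address → Address → ℕ
dist [] b = length b
dist (i ∷ a) [] = length (i ∷ a)
dist (i ∷ a) (j ∷ b) = if i ℕ.≡ᵇ j then dist a b else length (i ∷ a) + length (j ∷ b)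

-- A downward path: start vertex followed by successive child choices.
record DPath : Set where
  constructor dpath
  field
    start : Address
    steps : List ℕ
open DPath public

verts : DPath → List Address
verts P = map (λ k → start P ++ take k (steps P)) (upTo (suc (length (steps P))))

numVerts : DPath → ℕ
numVerts P = suc (length (steps P))

IsDownwardPath : Tree → DPath → Set
IsDownwardPath T P = Valid T (start P ++ steps P)

Independent : Tree → DPath → DPath → Set
Independent T P Q =
  ¬ (∃[ ℓ ] ∃[ u ] ∃[ w ] (IsLeaf T ℓ × u ∈ verts P × w ∈ verts Q × u ⊑ ℓ × w ⊑ ℓ))

vertexSet : {m : ℕ} → (Fin m → DPath) → List Address
vertexSet {m} 𝒫 = concatMap (λ i → verts (𝒫 i)) (allFin m)

-- Profile: multiset (list up to permutation) of distances over unordered pairs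
-- of distinct elements of the (duplicate-free) vertex list.
profile : List Address → List ℕ
profile [] = []
profile (x ∷ xs) = map (dist x) xs ++ profile xs

Homometric : List Address → List Address → Set
Homometric V₁ V₂ = Disjoint V₁ V₂ × (profile V₁ ↭ profile V₂)

module Submission where

-- Send the k-th vertex of 𝒫₁ i to the k-th vertex of 𝒫₂ i; this is an isometry between
-- the two vertex sets, so the profiles agree term by term. Inside one path a distance
-- depends only on the two positions. For i ≠ j independence makes the start vertices
-- incomparable, so the distance is d(start 𝒫 i, start 𝒫 j) plus the two depths, and for
-- incomparable children p·a, q·b one has d(p·a, q·b) = d(p, q) + 2 whatever siblings
-- a, b are.

open import Defs
open import Data.Nat using (ℕ; zero; suc; _+_; _<_; _≡ᵇ_; _≟_; _⊓_; s≤s; z≤n)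
open import Data.Nat.Properties using (≡ᵇ⇒≡; ≡⇒≡ᵇ; <-irrelevant; suc-injective; +-suc; +-comm)
open import Data.Nat.Tactic.RingSolver using (solve-∀)
open import Data.Fin as Fin using (Fin; fromℕ<)
open import Data.Bool using (true; false)
open import Data.List using (List; []; [_]; _∷_; _++_; _∷ʳ_; length; map; take; upTo; concatMap; allFin; lookup)
open import Data.List.Properties
  using (length-take; length-++; ++-identityʳ; ++-assoc; map-∘; map-cong; map-concatMap; concatMap-cong)
open import Data.List.Membership.Propositional using (_∈_)
open import Data.List.Relation.Unary.Any using (here)
open import Data.List.Relation.Binary.Disjoint.Propositional using (Disjoint)
open import Data.List.Relation.Binary.Permutation.Propositional using (↭-reflexive)
open import Data.Product using (Σ; _×_; _,_; ∃-syntax; uncurry)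
open import Data.Unit using (tt)
open import Data.Empty using (⊥-elim)
open import Function using (_∘_)
open import Relation.Nullary using (¬_; yes; no)
open import Relation.Binary.PropositionalEquality using (_≡_; _≢_; refl; sym; trans; cong; cong₂; subst; module ≡-Reasoning)
open ≡-Reasoning

private
  variable
    A : Set

⊑-trans : ∀ {u v w} → u ⊑ v → v ⊑ w → u ⊑ w
⊑-trans {u} (s , refl) (t , refl) = s ++ t , sym (++-assoc u s t)

Incomparable : Address → Address → Set
Incomparable u w = ¬ u ⊑ w × ¬ w ⊑ u

Incomparable-∷⁻ : ∀ {i a b} → Incomparable (i ∷ a) (i ∷ b) → Incomparable a b
Incomparable-∷⁻ {i} (a⋢b , b⋢a) =
  (λ (s , eq) → a⋢b (s , cong (i ∷_) eq)) , (λ (s , eq) → b⋢a (s , cong (i ∷_) eq))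

dist-∷-≡ : ∀ i a b → dist (i ∷ a) (i ∷ b) ≡ dist a b
dist-∷-≡ i a b with i ≡ᵇ i | ≡⇒≡ᵇ i i refl
... | true | _ = refl

dist-∷-≢ : ∀ {i j} a b → i ≢ j → dist (i ∷ a) (j ∷ b) ≡ length (i ∷ a) + length (j ∷ b)
dist-∷-≢ {i} {j} a b i≢j with i ≡ᵇ j | ≡ᵇ⇒≡ i j
... | false | _ = refl
... | true | i≡j = ⊥-elim (i≢j (i≡j tt))

dist-++ˡ : ∀ v a b → dist (v ++ a) (v ++ b) ≡ dist a b
dist-++ˡ [] a b = refl
dist-++ˡ (i ∷ v) a b = trans (dist-∷-≡ i (v ++ a) (v ++ b)) (dist-++ˡ v a b)

dist-++-incomparable : ∀ v z s t → Incomparable v z →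
  dist (v ++ s) (z ++ t) ≡ dist v z + length s + length t
dist-++-incomparable [] z s t (v⋢z , _) = ⊥-elim (v⋢z (z , refl))
dist-++-incomparable v@(_ ∷ _) [] s t (_ , z⋢v) = ⊥-elim (z⋢v (v , refl))
dist-++-incomparable (i ∷ v) (j ∷ z) s t inc with i ≟ j
... | yes refl = begin
  dist (i ∷ v ++ s) (i ∷ z ++ t)
    ≡⟨ dist-∷-≡ i (v ++ s) (z ++ t) ⟩
  dist (v ++ s) (z ++ t)
    ≡⟨ dist-++-incomparable v z s t (Incomparable-∷⁻ inc) ⟩
  dist v z + length s + length t
    ≡⟨ cong (λ d → d + length s + length t) (dist-∷-≡ i v z) ⟨
  dist (i ∷ v) (i ∷ z) + length s + length t ∎
... | no i≢j = begin
  dist (i ∷ v ++ s) (j ∷ z ++ t)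
    ≡⟨ dist-∷-≢ (v ++ s) (z ++ t) i≢j ⟩
  suc (length (v ++ s)) + suc (length (z ++ t))
    ≡⟨ cong₂ (λ x y → suc x + suc y) (length-++ v) (length-++ z) ⟩
  suc (length v + length s) + suc (length z + length t)
    ≡⟨ rearrange (length v) (length z) (length s) (length t) ⟩
  suc (length v) + suc (length z) + length s + length t
    ≡⟨ cong (λ d → d + length s + length t) (dist-∷-≢ v z i≢j) ⟨
  dist (i ∷ v) (j ∷ z) + length s + length t ∎
  where
  rearrange : ∀ a b c d → suc (a + c) + suc (b + d) ≡ suc a + suc b + c + d
  rearrange = solve-∀

length-∷ʳ : ∀ (xs : List A) x → length (xs ∷ʳ x) ≡ suc (length xs)
length-∷ʳ xs x = trans (length-++ xs) (+-comm (length xs) 1)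

dist-∷ʳ-incomparable : ∀ p q i j → Incomparable (p ∷ʳ i) (q ∷ʳ j) →
  dist (p ∷ʳ i) (q ∷ʳ j) ≡ suc (suc (dist p q))
dist-∷ʳ-incomparable [] [] i j (i⋢j , _) with i ≟ j
... | yes refl = ⊥-elim (i⋢j ([] , refl))
... | no i≢j = dist-∷-≢ [] [] i≢j
dist-∷ʳ-incomparable [] (k ∷ q) i j (i⋢q , _) with i ≟ k
... | yes refl = ⊥-elim (i⋢q (q ∷ʳ j , refl))
... | no i≢k = trans (dist-∷-≢ [] (q ∷ʳ j) i≢k) (cong (suc ∘ suc) (length-∷ʳ q j))
dist-∷ʳ-incomparable (k ∷ p) [] i j (_ , j⋢p) with k ≟ j
... | yes refl = ⊥-elim (j⋢p (p ∷ʳ i , refl))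
... | no k≢j = begin
  dist (k ∷ p ∷ʳ i) [ j ]     ≡⟨ dist-∷-≢ (p ∷ʳ i) [] k≢j ⟩
  suc (length (p ∷ʳ i)) + 1   ≡⟨ +-comm (suc (length (p ∷ʳ i))) 1 ⟩
  suc (suc (length (p ∷ʳ i))) ≡⟨ cong (suc ∘ suc) (length-∷ʳ p i) ⟩
  suc (suc (suc (length p)))  ∎
dist-∷ʳ-incomparable (k ∷ p) (l ∷ q) i j inc with k ≟ l
... | yes refl = begin
  dist (k ∷ p ∷ʳ i) (k ∷ q ∷ʳ j)   ≡⟨ dist-∷-≡ k (p ∷ʳ i) (q ∷ʳ j) ⟩
  dist (p ∷ʳ i) (q ∷ʳ j)           ≡⟨ dist-∷ʳ-incomparable p q i j (Incomparable-∷⁻ inc) ⟩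
  suc (suc (dist p q))             ≡⟨ cong (suc ∘ suc) (dist-∷-≡ k p q) ⟨
  suc (suc (dist (k ∷ p) (k ∷ q))) ∎
... | no k≢l = begin
  dist (k ∷ p ∷ʳ i) (l ∷ q ∷ʳ j)                ≡⟨ dist-∷-≢ (p ∷ʳ i) (q ∷ʳ j) k≢l ⟩
  suc (length (p ∷ʳ i)) + suc (length (q ∷ʳ j)) ≡⟨ cong₂ (λ x y → suc x + suc y) (length-∷ʳ p i) (length-∷ʳ q j) ⟩
  suc (suc (length p)) + suc (suc (length q))   ≡⟨ cong suc (+-suc (suc (length p)) (suc (length q))) ⟩
  suc (suc (suc (length p) + suc (length q)))   ≡⟨ cong (suc ∘ suc) (dist-∷-≢ p q k≢l) ⟨
  suc (suc (dist (k ∷ p) (l ∷ q)))              ∎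

dist-siblings : ∀ {v v′ z z′} → Sibling v v′ → Sibling z z′ →
  Incomparable v z → Incomparable v′ z′ → dist v z ≡ dist v′ z′
dist-siblings (p , i , i′ , _ , refl , refl) (q , j , j′ , _ , refl , refl) inc inc′ =
  trans (dist-∷ʳ-incomparable p q i j inc) (sym (dist-∷ʳ-incomparable p q i′ j′ inc′))

length-take-cong : ∀ n {xs ys : List A} → length xs ≡ length ys →
  length (take n xs) ≡ length (take n ys)
length-take-cong n {xs} {ys} eq =
  trans (length-take n xs) (trans (cong (n ⊓_) eq) (sym (length-take n ys)))

dist-take-cong : ∀ k l (s s′ : List ℕ) → length s ≡ length s′ →
  dist (take k s) (take l s) ≡ dist (take k s′) (take l s′)
dist-take-cong k l [] [] _ = refl
dist-take-cong zero l (_ ∷ _) (_ ∷ _) eq = length-take-cong l eq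
dist-take-cong (suc k) zero (_ ∷ s) (_ ∷ s′) eq = cong suc (length-take-cong k (suc-injective eq))
dist-take-cong (suc k) (suc l) (x ∷ s) (y ∷ s′) eq = begin
  dist (x ∷ take k s) (x ∷ take l s)     ≡⟨ dist-∷-≡ x (take k s) (take l s) ⟩
  dist (take k s) (take l s)             ≡⟨ dist-take-cong k l s s′ (suc-injective eq) ⟩
  dist (take k s′) (take l s′)           ≡⟨ dist-∷-≡ y (take k s′) (take l s′) ⟨
  dist (y ∷ take k s′) (y ∷ take l s′)   ∎

pathVertex : DPath → ℕ → Address
pathVertex P k = start P ++ take k (steps P)

dist-pathVertex-cong : ∀ P Q k l → length (steps P) ≡ length (steps Q) →
  dist (pathVertex P k) (pathVertex P l) ≡ dist (pathVertex Q k) (pathVertex Q l)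
dist-pathVertex-cong P Q k l eq = begin
  dist (pathVertex P k) (pathVertex P l)        ≡⟨ dist-++ˡ (start P) _ _ ⟩
  dist (take k (steps P)) (take l (steps P))    ≡⟨ dist-take-cong k l (steps P) (steps Q) eq ⟩
  dist (take k (steps Q)) (take l (steps Q))    ≡⟨ dist-++ˡ (start Q) _ _ ⟨
  dist (pathVertex Q k) (pathVertex Q l)        ∎

dist-pathVertex-siblings : ∀ {P P′ R R′} k l →
  Sibling (start P) (start P′) → Sibling (start R) (start R′) →
  length (steps P) ≡ length (steps P′) → length (steps R) ≡ length (steps R′) →
  Incomparable (start P) (start R) → Incomparable (start P′) (start R′) →
  dist (pathVertex P k) (pathVertex R l) ≡ dist (pathVertex P′ k) (pathVertex R′ l)
dist-pathVertex-siblings {P} {P′} {R} {R′} k l sibP sibR lenP lenR inc inc′ = begin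
  dist (pathVertex P k) (pathVertex R l)
    ≡⟨ dist-++-incomparable (start P) (start R) _ _ inc ⟩
  dist (start P) (start R) + length (take k (steps P)) + length (take l (steps R))
    ≡⟨ cong₂ _+_ (cong₂ _+_ (dist-siblings sibP sibR inc inc′) (length-take-cong k lenP))
                 (length-take-cong l lenR) ⟩
  dist (start P′) (start R′) + length (take k (steps P′)) + length (take l (steps R′))
    ≡⟨ dist-++-incomparable (start P′) (start R′) _ _ inc′ ⟨
  dist (pathVertex P′ k) (pathVertex R′ l) ∎

valid-++⁻ˡ : ∀ t a {b} → Valid t (a ++ b) → Valid t a
valid-++⁻ˡ t [] _ = tt
valid-++⁻ˡ (node ts) (i ∷ a) (i<n , valid) = i<n , valid-++⁻ˡ _ a valid

IsLeaf-child : ∀ ts {i ℓ} (i<n : i < length ts) →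
  IsLeaf (lookup ts (fromℕ< i<n)) ℓ → IsLeaf (node ts) (i ∷ ℓ)
IsLeaf-child ts {i} {ℓ} i<n (valid , childless) = (i<n , valid) , λ k (i<n′ , valid′) →
  childless k (subst (λ h → Valid (lookup ts (fromℕ< h)) (ℓ ∷ʳ k)) (<-irrelevant i<n′ i<n) valid′)

leaf : ∀ t → Σ Address (IsLeaf t)
leaf (node []) = [] , tt , λ _ ()
leaf (node (t ∷ ts)) with leaf t
... | ℓ , isLeaf = 0 ∷ ℓ , IsLeaf-child (t ∷ ts) (s≤s z≤n) isLeaf

leaf-below : ∀ t a → Valid t a → ∃[ ℓ ] (a ⊑ ℓ × IsLeaf t ℓ)
leaf-below t [] _ with leaf t
... | ℓ , isLeaf = ℓ , (ℓ , refl) , isLeaf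
leaf-below (node ts) (i ∷ a) (i<n , valid) with leaf-below _ a valid
... | ℓ , (s , refl) , isLeaf = i ∷ ℓ , (s , refl) , IsLeaf-child ts i<n isLeaf

Independent-sym : ∀ {T P Q} → Independent T P Q → Independent T Q P
Independent-sym ind (ℓ , u , w , isLeaf , u∈Q , w∈P , u⊑ℓ , w⊑ℓ) =
  ind (ℓ , w , u , isLeaf , w∈P , u∈Q , w⊑ℓ , u⊑ℓ)

start-∈-verts : ∀ P → start P ∈ verts P
start-∈-verts P = here (sym (++-identityʳ (start P)))

independent⇒start⋢start : ∀ {T P Q} → IsDownwardPath T Q → Independent T P Q →
  ¬ start P ⊑ start Q
independent⇒start⋢start {T} {P} {Q} validQ ind P⊑Q
  with leaf-below T (start Q) (valid-++⁻ˡ T (start Q) validQ)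
... | ℓ , Q⊑ℓ , isLeaf =
  ind (ℓ , _ , _ , isLeaf , start-∈-verts P , start-∈-verts Q , ⊑-trans P⊑Q Q⊑ℓ , Q⊑ℓ)

independent⇒incomparable : ∀ {T P Q} → IsDownwardPath T P → IsDownwardPath T Q →
  Independent T P Q → Incomparable (start P) (start Q)
independent⇒incomparable validP validQ ind =
  independent⇒start⋢start validQ ind , independent⇒start⋢start validP (Independent-sym ind)

profile-map-cong : (f g : A → Address) → (∀ x y → dist (f x) (f y) ≡ dist (g x) (g y)) →
  ∀ xs → profile (map f xs) ≡ profile (map g xs)
profile-map-cong f g isometry [] = refl
profile-map-cong f g isometry (x ∷ xs) =
  cong₂ _++_ distancesFrom-x (profile-map-cong f g isometry xs)
  where
  distancesFrom-x : map (dist (f x)) (map f xs) ≡ map (dist (g x)) (map g xs)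
  distancesFrom-x = begin
    map (dist (f x)) (map f xs)   ≡⟨ map-∘ xs ⟨
    map (dist (f x) ∘ f) xs       ≡⟨ map-cong (isometry x) xs ⟩
    map (dist (g x) ∘ g) xs       ≡⟨ map-∘ xs ⟩
    map (dist (g x)) (map g xs)   ∎

positions : ∀ {m} → (Fin m → ℕ) → List (Fin m × ℕ)
positions {m} size = concatMap (λ i → map (i ,_) (upTo (size i))) (allFin m)

positions-cong : ∀ {m} {size size′ : Fin m → ℕ} → (∀ i → size i ≡ size′ i) →
  positions size ≡ positions size′
positions-cong {m} eq = concatMap-cong (λ i → cong (λ n → map (i ,_) (upTo n)) (eq i)) (allFin m)

familyVertex : ∀ {m} → (Fin m → DPath) → Fin m × ℕ → Address
familyVertex 𝒫 = uncurry (pathVertex ∘ 𝒫)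

vertexSet-≡-map : ∀ {m} (𝒫 : Fin m → DPath) →
  vertexSet 𝒫 ≡ map (familyVertex 𝒫) (positions (numVerts ∘ 𝒫))
vertexSet-≡-map {m} 𝒫 = begin
  vertexSet 𝒫
    ≡⟨ concatMap-cong (λ i → map-∘ (upTo (numVerts (𝒫 i)))) (allFin m) ⟩
  concatMap (λ i → map (familyVertex 𝒫) (map (i ,_) (upTo (numVerts (𝒫 i))))) (allFin m)
    ≡⟨ map-concatMap (familyVertex 𝒫) _ (allFin m) ⟨
  map (familyVertex 𝒫) (positions (numVerts ∘ 𝒫)) ∎

mainTheorem3 : (T : Tree) (m : ℕ) (𝒫₁ 𝒫₂ : Fin m → DPath)
    → (∀ i → IsDownwardPath T (𝒫₁ i))
    → (∀ i → IsDownwardPath T (𝒫₂ i))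
    → (∀ i j → i ≢ j → Disjoint (verts (𝒫₁ i)) (verts (𝒫₁ j)))
    → (∀ i j → i ≢ j → Disjoint (verts (𝒫₂ i)) (verts (𝒫₂ j)))
    → Disjoint (vertexSet 𝒫₁) (vertexSet 𝒫₂)
    → (∀ i → numVerts (𝒫₂ i) ≡ numVerts (𝒫₁ i))
    → (∀ i → Sibling (start (𝒫₁ i)) (start (𝒫₂ i)))
    → (∀ i j → i ≢ j → Independent T (𝒫₁ i) (𝒫₁ j))
    → (∀ i j → i ≢ j → Independent T (𝒫₂ i) (𝒫₂ j))
    → (∀ i j → Independent T (𝒫₁ i) (𝒫₂ j))
    → Homometric (vertexSet 𝒫₁) (vertexSet 𝒫₂)
mainTheorem3 T m 𝒫₁ 𝒫₂ valid₁ valid₂ _ _ disjoint sizes siblings indep₁ indep₂ _ =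
  disjoint , ↭-reflexive (begin
    profile (vertexSet 𝒫₁)
      ≡⟨ cong profile (vertexSet-≡-map 𝒫₁) ⟩
    profile (map (familyVertex 𝒫₁) (positions (numVerts ∘ 𝒫₁)))
      ≡⟨ profile-map-cong _ _ isometry (positions (numVerts ∘ 𝒫₁)) ⟩
    profile (map (familyVertex 𝒫₂) (positions (numVerts ∘ 𝒫₁)))
      ≡⟨ cong (profile ∘ map (familyVertex 𝒫₂)) (positions-cong (sym ∘ sizes)) ⟩
    profile (map (familyVertex 𝒫₂) (positions (numVerts ∘ 𝒫₂)))
      ≡⟨ cong profile (vertexSet-≡-map 𝒫₂) ⟨
    profile (vertexSet 𝒫₂) ∎)
  where
  sameLength : ∀ i → length (steps (𝒫₁ i)) ≡ length (steps (𝒫₂ i))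
  sameLength i = sym (suc-injective (sizes i))

  isometry : ∀ x y →
    dist (familyVertex 𝒫₁ x) (familyVertex 𝒫₁ y) ≡ dist (familyVertex 𝒫₂ x) (familyVertex 𝒫₂ y)
  isometry (i , k) (j , l) with i Fin.≟ j
  ... | yes refl = dist-pathVertex-cong (𝒫₁ i) (𝒫₂ i) k l (sameLength i)
  ... | no i≢j = dist-pathVertex-siblings k l (siblings i) (siblings j) (sameLength i) (sameLength j)
    (independent⇒incomparable (valid₁ i) (valid₁ j) (indep₁ i j i≢j))
    (independent⇒incomparable (valid₂ i) (valid₂ j) (indep₂ i j i≢j))
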